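{- Let $G$ be a finite simple $r$-regular graph with $r \geq 2$, and let $p, q$ be non-negative integers with $p \leq q < 3$. Then \[ \alpha_p(G) \leq \alpha_q(L(G)). \]
   Context: For a graph $G$ and a non-negative integer $p$, a set $S \subseteq V(G)$ is $p$-independent if the subgraph induced by $S$ has maximum degree at most $p$; $\alpha_p(G)$ denotes the maximum cardinality of a $p$-independent set of $G$. $L(G)$ is the line graph of $G$. -}

module Defs where

open import Data.Nat using (ℕ; _≤_; _<_)
open import Data.Bool using (Bool; true; false; T; _∧_; _∨_; not)
open import Data.Fin using (Fin; _≟_)
import Data.Fin as Fin
open import Data.Fin.Properties using () renaming (_≟_ to _≟ᶠ_)
open import Data.List using (List; length; filter)
open import Data.List.Relation.Unary.Unique.Propositional using (Unique)
open import Data.List.Membership.Propositional using (_∈_)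
open import Data.Product using (Σ; _×_; _,_; proj₁; ∃)
open import Relation.Binary.PropositionalEquality using (_≡_)
open import Relation.Nullary.Decidable using (⌊_⌋)
open import Relation.Nullary using (¬_)
open import Data.List using (allFin)

-- A graph on an arbitrary vertex type, given by a Boolean adjacency function.
-- p-independence of a finite set S (a duplicate-free list of vertices):
-- the induced subgraph on S has maximum degree ≤ p, i.e. every v ∈ S has
-- at most p neighbours inside S.
IsPIndep : {V : Set} → (V → V → Bool) → ℕ → List V → Set
IsPIndep adj p S =
  Unique S × (∀ v → v ∈ S → length (filter (λ w → T? (adj v w)) S) ≤ p)
  where
    open import Data.Bool.Properties using (T?)

-- α_p(G) ≤ α_q(H), unfolded: every p-independent set of G is no larger than
-- some q-independent set of H (equivalently, max ≤ max over finite families).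
AlphaLe : {V W : Set} → (V → V → Bool) → ℕ → (W → W → Bool) → ℕ → Set
AlphaLe adjG p adjH q =
  ∀ S → IsPIndep adjG p S → Σ _ λ T → IsPIndep adjH q T × length S ≤ length T

record SimpleGraph (n : ℕ) : Set where
  field
    adj   : Fin n → Fin n → Bool
    sym   : ∀ u v → adj u v ≡ adj v u
    irrefl : ∀ v → adj v v ≡ false
open SimpleGraph public

degree : {n : ℕ} → SimpleGraph n → Fin n → ℕ
degree G v = length (filter (λ w → T? (adj G v w)) (allFin _))
  where open import Data.Bool.Properties using (T?)

IsRegular : {n : ℕ} → SimpleGraph n → ℕ → Set
IsRegular G r = ∀ v → degree G v ≡ r

Edge : {n : ℕ} → SimpleGraph n → Set
Edge {n} G = Σ (Fin n × Fin n) λ { (i , j) → (i Fin.< j) × T (adj G i j) }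

shareEnd : {n : ℕ} → (Fin n × Fin n) → (Fin n × Fin n) → Bool
shareEnd (a , b) (c , d) =
  ⌊ a ≟ᶠ c ⌋ ∨ ⌊ a ≟ᶠ d ⌋ ∨ ⌊ b ≟ᶠ c ⌋ ∨ ⌊ b ≟ᶠ d ⌋

sameEnds : {n : ℕ} → (Fin n × Fin n) → (Fin n × Fin n) → Bool
sameEnds (a , b) (c , d) = ⌊ a ≟ᶠ c ⌋ ∧ ⌊ b ≟ᶠ d ⌋

lineAdj : {n : ℕ} (G : SimpleGraph n) → Edge G → Edge G → Bool
lineAdj G (e , _) (f , _) = not (sameEnds e f) ∧ shareEnd e f

module Submission where

-- Let S be p-independent in G.  Since p ≤ 2, every s ∈ S has at most two neighbours in S.
-- It suffices to pick injectively an edge e(s) ∋ s for every s ∈ S such that e(s) and e(s′)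
-- meet only if s and s′ are adjacent: then e(s) meets at most d_S(s) ≤ p ≤ q of the chosen
-- edges.  Each s claims, through each neighbour w, either the edge sw (when w ∈ S; weight r)
-- or the vertex w itself (when w ∉ S and d_S(s) ≤ 1; weight 2).  Every s sends weight at
-- least 2r and every edge or vertex receives at most 2r, so by Hall's theorem one claim per
-- s can be chosen injectively; it determines e(s).  Suppose e(s) and e(s′) meet in a vertex
-- t ∉ {s, s′}.  If t ∉ S, both s and s′ claimed the vertex t.  If t ∈ S, then t has the
-- S-neighbours s and s′, so the edge chosen at t is e(s) or e(s′) or gives t a third one.

open import Data.Nat using (ℕ; zero; suc; _+_; _*_; _≤_; _<_; z≤n; s≤s; z<s; _≤?_; _<?_; NonZero; >-nonZero)
open import Data.Nat.Properties
open import Data.Bool using (Bool; true; false; T)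
open import Data.Empty using (⊥; ⊥-elim)
open import Data.Fin using (Fin; zero; suc)
open import Data.Fin.Properties using () renaming (_≟_ to _≟ᶠ_)
open import Data.Product using (Σ; ∃; _×_; _,_; proj₁; proj₂)
open import Data.Sum using (_⊎_; inj₁; inj₂)
open import Function using (_∘_; id)
open import Function.Definitions using (Injective)
open import Level using (0ℓ)
open import Relation.Nullary using (¬_; Dec; yes; no; does; contradiction)
open import Relation.Nullary.Decidable using (_×-dec_; dec-true)
open import Relation.Unary using (Pred; Decidable)
open import Relation.Binary.PropositionalEquality hiding ([_])
open import Algebra.Properties.Semiring.Sum +-*-semiring
  using (sum; sum-syntax; ∑-comm; ∑-distrib-+; *-distribˡ-sum; *-distribʳ-sum; sum-cong-≗; sum-replicate-zero)
open import Defs hiding (sym)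

𝟙 : Bool → ℕ
𝟙 true  = 1
𝟙 false = 0

𝟙*≤ : ∀ b a → 𝟙 b * a ≤ a
𝟙*≤ true  a = ≤-reflexive (+-identityʳ a)
𝟙*≤ false a = z≤n

∑-mono-≤ : ∀ {n} {f g : Fin n → ℕ} → (∀ i → f i ≤ g i) → ∑[ i < n ] f i ≤ ∑[ i < n ] g i
∑-mono-≤ {zero}  f≤g = z≤n
∑-mono-≤ {suc n} f≤g = +-mono-≤ (f≤g zero) (∑-mono-≤ (f≤g ∘ suc))

∑-positive : ∀ {n} (f : Fin n → ℕ) → 0 < ∑[ i < n ] f i → ∃ λ i → 0 < f i
∑-positive {suc n} f pos with f zero in eq
... | suc _ = zero , subst (0 <_) (sym eq) z<s
... | zero with ∑-positive (λ i → f (suc i)) pos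
...   | i , fi>0 = suc i , fi>0

∑-δ : ∀ {n} (j : Fin n) a → ∑[ i < n ] (𝟙 (does (i ≟ᶠ j)) * a) ≡ a
∑-δ {suc n} zero a = begin
  1 * a + ∑[ i < n ] (𝟙 (does (suc i ≟ᶠ zero)) * a)  ≡⟨ cong (_ +_) (sum-replicate-zero n) ⟩
  1 * a + 0                                          ≡⟨ +-identityʳ _ ⟩
  1 * a                                              ≡⟨ *-identityˡ a ⟩
  a                                                  ∎
  where open ≡-Reasoning
∑-δ {suc n} (suc j) a = ∑-δ j a

𝟙*-positive : ∀ {P : Set} (P? : Dec P) {a} → 0 < 𝟙 (does P?) * a → P × 0 < a
𝟙*-positive (yes p) {a} pos = p , subst (0 <_) (*-identityˡ a) pos
𝟙*-positive (no _)       ()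

≤𝟙* : ∀ {P : Set} (P? : Dec P) → P → ∀ {a b} → a ≤ b → a ≤ 𝟙 (does P?) * b
≤𝟙* P? p {b = b} a≤b rewrite dec-true P? p = ≤-trans a≤b (≤-reflexive (sym (*-identityˡ b)))

𝟙-mono : ∀ {a b} → (T a → T b) → 𝟙 a ≤ 𝟙 b
𝟙-mono {false}         _   = z≤n
𝟙-mono {true}  {true}  _   = ≤-refl
𝟙-mono {true}  {false} a⇒b = ⊥-elim (a⇒b _)

module _ where
  open import Data.Fin.Subset using (Subset; _∈_; _∉_; _∪_; _─_; ∣_∣; Nonempty; outside; inside)
  open import Data.Fin.Subset.Properties using (_∈?_; ∣q∣≤∣p∪q∣)
  open import Data.Vec using ([]; _∷_; here; there; tabulate)
  open import Data.Vec.Properties using (lookup⇒[]=; []=⇒lookup; lookup∘tabulate)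

  ⟦_⟧ : ∀ {n} {P : Pred (Fin n) 0ℓ} → Decidable P → Subset n
  ⟦ P? ⟧ = tabulate (does ∘ P?)

  module _ {n} {P : Pred (Fin n) 0ℓ} (P? : Decidable P) where

    ∈⟦⟧⁺ : ∀ {x} → P x → x ∈ ⟦ P? ⟧
    ∈⟦⟧⁺ {x} px = lookup⇒[]= x _ (trans (lookup∘tabulate _ x) (dec-true (P? x) px))

    ∈⟦⟧⁻ : ∀ {x} → x ∈ ⟦ P? ⟧ → P x
    ∈⟦⟧⁻ {x} x∈ with P? x | trans (sym (lookup∘tabulate (does ∘ P?) x)) ([]=⇒lookup x∈)
    ... | yes px | _  = px
    ... | no  _  | ()

  x∈p─q⇒x∉q : ∀ {n} {p q : Subset n} {x} → x ∈ p ─ q → x ∉ q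
  x∈p─q⇒x∉q {p = _ ∷ p} {outside ∷ q} (there x∈) (there x∈q) = x∈p─q⇒x∉q x∈ x∈q
  x∈p─q⇒x∉q {p = _ ∷ p} {inside ∷ q} (there x∈) (there x∈q) = x∈p─q⇒x∉q x∈ x∈q
  x∈p─q⇒x∉q {p = inside ∷ p} {outside ∷ q} here ()

  ∣p∪q∣≡∣p∣+∣q─p∣ : ∀ {n} (p q : Subset n) → ∣ p ∪ q ∣ ≡ ∣ p ∣ + ∣ q ─ p ∣
  ∣p∪q∣≡∣p∣+∣q─p∣ [] [] = refl
  ∣p∪q∣≡∣p∣+∣q─p∣ (inside ∷ p) (_ ∷ q) = cong suc (∣p∪q∣≡∣p∣+∣q─p∣ p q)
  ∣p∪q∣≡∣p∣+∣q─p∣ (outside ∷ p) (inside ∷ q) =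
    trans (cong suc (∣p∪q∣≡∣p∣+∣q─p∣ p q)) (sym (+-suc ∣ p ∣ _))
  ∣p∪q∣≡∣p∣+∣q─p∣ (outside ∷ p) (outside ∷ q) = ∣p∪q∣≡∣p∣+∣q─p∣ p q

  ∣p∣≤∣p─q∣+∣q∣ : ∀ {n} (p q : Subset n) → ∣ p ∣ ≤ ∣ p ─ q ∣ + ∣ q ∣
  ∣p∣≤∣p─q∣+∣q∣ p q = begin
    ∣ p ∣               ≤⟨ ∣q∣≤∣p∪q∣ q p ⟩
    ∣ q ∪ p ∣           ≡⟨ ∣p∪q∣≡∣p∣+∣q─p∣ q p ⟩
    ∣ q ∣ + ∣ p ─ q ∣   ≡⟨ +-comm ∣ q ∣ _ ⟩
    ∣ p ─ q ∣ + ∣ q ∣   ∎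
    where open ≤-Reasoning

  ∣p∣>0⇒Nonempty : ∀ {n} (p : Subset n) → 0 < ∣ p ∣ → Nonempty p
  ∣p∣>0⇒Nonempty (inside ∷ p) _ = zero , here
  ∣p∣>0⇒Nonempty (outside ∷ p) pos with ∣p∣>0⇒Nonempty p pos
  ... | x , x∈p = suc x , there x∈p

  ∣p∣*c≡∑ : ∀ {n} (p : Subset n) c → ∣ p ∣ * c ≡ ∑[ x < n ] (𝟙 (does (x ∈? p)) * c)
  ∣p∣*c≡∑ []            c = refl
  ∣p∣*c≡∑ (inside ∷ p)  c = cong₂ _+_ (sym (+-identityʳ c)) (∣p∣*c≡∑ p c)
  ∣p∣*c≡∑ (outside ∷ p) c = ∣p∣*c≡∑ p c

-- Hall's theorem

module Hall {k m : ℕ} {R : Fin k → Fin m → Set} (R? : ∀ x y → Dec (R x y)) where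
  open import Data.Fin.Properties using (any?)
  open import Data.Fin.Subset
    using (Subset; _∈_; _⊆_; _∪_; _─_; _-_; ∣_∣; ⁅_⁆; ⊤; Nonempty)
  open import Data.Fin.Subset.Properties
  open import Data.Nat.Induction using (<-wellFounded)
  open import Data.Sum using ([_,_]′)
  open import Induction.WellFounded using (Acc; acc)

  IsNeighbour : Subset m → Subset k → Pred (Fin m) 0ℓ
  IsNeighbour B X y = y ∈ B × ∃ λ x → x ∈ X × R x y

  isNeighbour? : ∀ B X → Decidable (IsNeighbour B X)
  isNeighbour? B X y = y ∈? B ×-dec any? (λ x → x ∈? X ×-dec R? x y)

  N : Subset m → Subset k → Subset m
  N B X = ⟦ isNeighbour? B X ⟧

  N⁺ : ∀ {B X x y} → y ∈ B → x ∈ X → R x y → y ∈ N B X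
  N⁺ {B} {X} y∈B x∈X r = ∈⟦⟧⁺ (isNeighbour? B X) (y∈B , _ , x∈X , r)

  N⁻ : ∀ {B X y} → y ∈ N B X → IsNeighbour B X y
  N⁻ {B} {X} = ∈⟦⟧⁻ (isNeighbour? B X)

  HallCondition : Subset k → Subset m → Set
  HallCondition A B = ∀ {X} → X ⊆ A → ∣ X ∣ ≤ ∣ N B X ∣

  record Matching (A : Subset k) (B : Subset m) : Set where
    field
      match           : ∀ {x} → x ∈ A → Fin m
      match-∈         : ∀ {x} (x∈A : x ∈ A) → match x∈A ∈ B
      match-related   : ∀ {x} (x∈A : x ∈ A) → R x (match x∈A)
      match-injective : ∀ {x x′} (x∈A : x ∈ A) (x′∈A : x′ ∈ A) →
                        match x∈A ≡ match x′∈A → x ≡ x′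
  open Matching

  matching-⁅⁆ : ∀ {a b} → R a b → Matching ⁅ a ⁆ ⁅ b ⁆
  matching-⁅⁆ {a} {b} r = record
    { match           = λ _ → b
    ; match-∈         = λ _ → x∈⁅x⁆ b
    ; match-related   = λ x∈⁅a⁆ → subst (λ x → R x b) (sym (x∈⁅y⁆⇒x≡y a x∈⁅a⁆)) r
    ; match-injective = λ x∈⁅a⁆ x′∈⁅a⁆ _ →
                          trans (x∈⁅y⁆⇒x≡y a x∈⁅a⁆) (sym (x∈⁅y⁆⇒x≡y a x′∈⁅a⁆))
    }

  matching-into-N : ∀ {A B} → Matching A B → Matching A (N B A)
  matching-into-N M = record
    { match           = match M
    ; match-∈         = λ x∈A → N⁺ (match-∈ M x∈A) x∈A (match-related M x∈A)
    ; match-related   = match-related M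
    ; match-injective = match-injective M
    }

  glue : ∀ {A B X C} → C ⊆ B → Matching X C → Matching (A ─ X) (B ─ C) → Matching A B
  glue {A} {B} {X} {C} C⊆B M₁ M₂ = record
    { match           = f
    ; match-∈         = f-∈
    ; match-related   = f-related
    ; match-injective = f-injective
    }
    where
    side : ∀ {x} → x ∈ A → x ∈ X ⊎ x ∈ A ─ X
    side {x} x∈A with x ∈? X
    ... | yes x∈X = inj₁ x∈X
    ... | no  x∉X = inj₂ (x∈p∧x∉q⇒x∈p─q x∈A x∉X)

    f : ∀ {x} → x ∈ A → Fin m
    f x∈A = [ match M₁ , match M₂ ]′ (side x∈A)

    f-∈ : ∀ {x} (x∈A : x ∈ A) → f x∈A ∈ B
    f-∈ x∈A with side x∈A
    ... | inj₁ x∈X   = C⊆B (match-∈ M₁ x∈X)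
    ... | inj₂ x∈A─X = p─q⊆p B C (match-∈ M₂ x∈A─X)

    f-related : ∀ {x} (x∈A : x ∈ A) → R x (f x∈A)
    f-related x∈A with side x∈A
    ... | inj₁ x∈X   = match-related M₁ x∈X
    ... | inj₂ x∈A─X = match-related M₂ x∈A─X

    apart : ∀ {x x′} (x∈X : x ∈ X) (x′∈A─X : x′ ∈ A ─ X) → match M₁ x∈X ≢ match M₂ x′∈A─X
    apart x∈X x′∈A─X eq =
      x∈p─q⇒x∉q (subst (_∈ B ─ C) (sym eq) (match-∈ M₂ x′∈A─X)) (match-∈ M₁ x∈X)

    f-injective : ∀ {x x′} (x∈A : x ∈ A) (x′∈A : x′ ∈ A) → f x∈A ≡ f x′∈A → x ≡ x′
    f-injective x∈A x′∈A eq with side x∈A | side x′∈A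
    ... | inj₁ x∈X   | inj₁ x′∈X   = match-injective M₁ x∈X x′∈X eq
    ... | inj₂ x∈A─X | inj₂ x′∈A─X = match-injective M₂ x∈A─X x′∈A─X eq
    ... | inj₁ x∈X   | inj₂ x′∈A─X = contradiction eq (apart x∈X x′∈A─X)
    ... | inj₂ x∈A─X | inj₁ x′∈X   = contradiction (sym eq) (apart x′∈X x∈A─X)

  N⊆B : ∀ {B X} → N B X ⊆ B
  N⊆B = proj₁ ∘ N⁻

  N-∪ : ∀ {B X Y} → N B (X ∪ Y) ⊆ N B X ∪ N B Y
  N-∪ {X = X} {Y} y∈N with N⁻ y∈N
  ... | y∈B , x , x∈X∪Y , r with x∈p∪q⁻ X Y x∈X∪Y
  ...   | inj₁ x∈X = x∈p∪q⁺ (inj₁ (N⁺ y∈B x∈X r))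
  ...   | inj₂ x∈Y = x∈p∪q⁺ (inj₂ (N⁺ y∈B x∈Y r))

  N-─ : ∀ {B C Y} → N B Y ─ C ⊆ N (B ─ C) Y
  N-─ {B} {C} {Y} y∈N─C with N⁻ (p─q⊆p (N B Y) C y∈N─C)
  ... | y∈B , x , x∈Y , r = N⁺ (x∈p∧x∉q⇒x∈p─q y∈B (x∈p─q⇒x∉q y∈N─C)) x∈Y r

  HallCondition-⊆ : ∀ {A A′ B} → A′ ⊆ A → HallCondition A B → HallCondition A′ B
  HallCondition-⊆ A′⊆A H X⊆A′ = H (A′⊆A ∘ X⊆A′)

  HallCondition-─-critical : ∀ {A B X} → HallCondition A B → X ⊆ A → ∣ N B X ∣ ≤ ∣ X ∣ →
                             HallCondition (A ─ X) (B ─ N B X)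
  HallCondition-─-critical {A} {B} {X} H X⊆A critical {Y} Y⊆A─X = +-cancelˡ-≤ ∣ X ∣ _ _ (begin
    ∣ X ∣ + ∣ Y ∣                    ≤⟨ +-monoʳ-≤ ∣ X ∣ (p⊆q⇒∣p∣≤∣q∣ {p = Y} Y⊆Y─X) ⟩
    ∣ X ∣ + ∣ Y ─ X ∣                ≡⟨ ∣p∪q∣≡∣p∣+∣q─p∣ X Y ⟨
    ∣ X ∪ Y ∣                        ≤⟨ H X∪Y⊆A ⟩
    ∣ N B (X ∪ Y) ∣                  ≤⟨ p⊆q⇒∣p∣≤∣q∣ (N-∪ {B} {X} {Y}) ⟩
    ∣ N B X ∪ N B Y ∣                ≡⟨ ∣p∪q∣≡∣p∣+∣q─p∣ (N B X) (N B Y) ⟩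
    ∣ N B X ∣ + ∣ N B Y ─ N B X ∣    ≤⟨ +-mono-≤ critical (p⊆q⇒∣p∣≤∣q∣ (N-─ {B} {N B X} {Y})) ⟩
    ∣ X ∣ + ∣ N (B ─ N B X) Y ∣      ∎)
    where
    open ≤-Reasoning
    Y⊆Y─X : Y ⊆ Y ─ X
    Y⊆Y─X y∈Y = x∈p∧x∉q⇒x∈p─q y∈Y (x∈p─q⇒x∉q (Y⊆A─X y∈Y))
    X∪Y⊆A : X ∪ Y ⊆ A
    X∪Y⊆A x∈X∪Y with x∈p∪q⁻ X Y x∈X∪Y
    ... | inj₁ x∈X = X⊆A x∈X
    ... | inj₂ x∈Y = p─q⊆p A X (Y⊆A─X x∈Y)

  HallCondition-remove : ∀ {A B a} b → a ∈ A →
    (∀ {Y} → Y ⊆ A → Nonempty Y → ∣ Y ∣ < ∣ A ∣ → ∣ Y ∣ < ∣ N B Y ∣) →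
    HallCondition (A - a) (B - b)
  HallCondition-remove {A} {B} {a} b a∈A surplus {Y} Y⊆A-a with nonempty? Y
  ... | no Y=∅ rewrite Empty-unique Y=∅ | ∣⊥∣≡0 k = z≤n
  ... | yes Y≠∅ = ≤-pred (begin-strict
    ∣ Y ∣                            <⟨ surplus (p─q⊆p A ⁅ a ⁆ ∘ Y⊆A-a) Y≠∅ Y<A ⟩
    ∣ N B Y ∣                        ≤⟨ ∣p∣≤∣p─q∣+∣q∣ (N B Y) ⁅ b ⁆ ⟩
    ∣ N B Y - b ∣ + ∣ ⁅ b ⁆ ∣        ≤⟨ +-mono-≤ (p⊆q⇒∣p∣≤∣q∣ (N-─ {B} {⁅ b ⁆} {Y})) (≤-reflexive (∣⁅x⁆∣≡1 b)) ⟩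
    ∣ N (B - b) Y ∣ + 1              ≡⟨ +-comm _ 1 ⟩
    suc ∣ N (B - b) Y ∣              ∎)
    where
    open ≤-Reasoning
    Y<A : ∣ Y ∣ < ∣ A ∣
    Y<A = ≤-<-trans (p⊆q⇒∣p∣≤∣q∣ Y⊆A-a) (x∈p⇒∣p-x∣<∣p∣ a∈A)

  Critical : Subset k → Subset m → Subset k → Set
  Critical A B X = X ⊆ A × Nonempty X × ∣ X ∣ < ∣ A ∣ × ∣ N B X ∣ ≤ ∣ X ∣

  critical? : ∀ A B → Decidable (Critical A B)
  critical? A B X = X ⊆? A ×-dec nonempty? X ×-dec ∣ X ∣ <? ∣ A ∣ ×-dec ∣ N B X ∣ ≤? ∣ X ∣

  -- The two cases of the Halmos–Vaughan proof: split along a critical set if there is one,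
  -- otherwise match one element arbitrarily.
  hall-acc : ∀ A B → Acc _<_ ∣ A ∣ → HallCondition A B → Matching A B
  hall-acc A B (acc rec) H with anySubset? (critical? A B)
  ... | yes (X , X⊆A , X≠∅ , X<A , critical) =
    glue N⊆B (matching-into-N (hall-acc X B (rec X<A) (HallCondition-⊆ X⊆A H)))
             (hall-acc (A ─ X) (B ─ N B X) (rec A─X<A) (HallCondition-─-critical H X⊆A critical))
    where
    A─X<A : ∣ A ─ X ∣ < ∣ A ∣
    A─X<A = p∩q≢∅⇒∣p─q∣<∣p∣ A X (proj₁ X≠∅ , x∈p∩q⁺ (X⊆A (proj₂ X≠∅) , proj₂ X≠∅))
  ... | no ¬critical with nonempty? A
  ...   | no A=∅ = record
    { match           = λ x∈A → contradiction (_ , x∈A) A=∅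
    ; match-∈         = λ x∈A → contradiction (_ , x∈A) A=∅
    ; match-related   = λ x∈A → contradiction (_ , x∈A) A=∅
    ; match-injective = λ x∈A _ _ → contradiction (_ , x∈A) A=∅
    }
  ...   | yes (a , a∈A) with N⁻ (proj₂ b∈N)
    where
    b∈N : Nonempty (N B ⁅ a ⁆)
    b∈N = ∣p∣>0⇒Nonempty (N B ⁅ a ⁆)
            (subst (_≤ ∣ N B ⁅ a ⁆ ∣) (∣⁅x⁆∣≡1 a) (H (λ x∈⁅a⁆ → subst (_∈ A) (sym (x∈⁅y⁆⇒x≡y a x∈⁅a⁆)) a∈A)))
  ...     | b∈B , a′ , a′∈⁅a⁆ , r with refl ← x∈⁅y⁆⇒x≡y a a′∈⁅a⁆ =
    glue (λ y∈⁅b⁆ → subst (_∈ B) (sym (x∈⁅y⁆⇒x≡y _ y∈⁅b⁆)) b∈B) (matching-⁅⁆ r)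
         (hall-acc (A - a) (B - _) (rec (x∈p⇒∣p-x∣<∣p∣ a∈A)) (HallCondition-remove _ a∈A surplus))
    where
    surplus : ∀ {Y} → Y ⊆ A → Nonempty Y → ∣ Y ∣ < ∣ A ∣ → ∣ Y ∣ < ∣ N B Y ∣
    surplus Y⊆A Y≠∅ Y<A = ≰⇒> (λ critical → ¬critical (_ , Y⊆A , Y≠∅ , Y<A , critical))

  hall : (∀ X → ∣ X ∣ ≤ ∣ N ⊤ X ∣) → Σ (Fin k → Fin m) λ f → (∀ x → R x (f x)) × Injective _≡_ _≡_ f
  hall H = (λ x → match M (∈⊤ {x = x})) , (λ x → match-related M ∈⊤) , match-injective M ∈⊤ ∈⊤
    where
    M : Matching ⊤ ⊤
    M = hall-acc ⊤ ⊤ (<-wellFounded _) (λ {X} _ → H X)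

module _ {k m : ℕ} (w : Fin k → Fin m → ℕ) where
  open Hall (λ x y → 0 <? w x y)
  open import Data.Fin.Subset using (∣_∣; ⊤)
  open import Data.Fin.Subset.Properties using (_∈?_; ∈⊤)

  -- Double counting the weight leaving X: every y carrying some of it lies in N ⊤ X.
  hallCondition-weighted : ∀ c .{{_ : NonZero c}} →
    (∀ x → c ≤ ∑[ y < m ] w x y) → (∀ y → ∑[ x < k ] w x y ≤ c) →
    ∀ X → ∣ X ∣ ≤ ∣ N ⊤ X ∣
  hallCondition-weighted c leaving arriving X = *-cancelʳ-≤ ∣ X ∣ ∣ N ⊤ X ∣ c (begin
    ∣ X ∣ * c                                          ≡⟨ ∣p∣*c≡∑ X c ⟩
    ∑[ x < k ] (χX x * c)                              ≤⟨ ∑-mono-≤ (λ x → *-monoʳ-≤ (χX x) (leaving x)) ⟩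
    ∑[ x < k ] (χX x * ∑[ y < m ] w x y)               ≡⟨ sum-cong-≗ (λ x → *-distribˡ-sum (χX x) (w x)) ⟩
    ∑[ x < k ] ∑[ y < m ] (χX x * w x y)               ≡⟨ ∑-comm (λ x y → χX x * w x y) ⟩
    ∑[ y < m ] ∑[ x < k ] (χX x * w x y)               ≤⟨ ∑-mono-≤ into-N ⟩
    ∑[ y < m ] (𝟙 (does (y ∈? N ⊤ X)) * c)            ≡⟨ ∣p∣*c≡∑ (N ⊤ X) c ⟨
    ∣ N ⊤ X ∣ * c                                      ∎)
    where
    open ≤-Reasoning
    χX : Fin k → ℕ
    χX x = 𝟙 (does (x ∈? X))

    into-N : ∀ y → ∑[ x < k ] (χX x * w x y) ≤ 𝟙 (does (y ∈? N ⊤ X)) * c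
    into-N y with y ∈? N ⊤ X
    ... | yes _ = begin
      ∑[ x < k ] (χX x * w x y)  ≤⟨ ∑-mono-≤ (λ x → 𝟙*≤ (does (x ∈? X)) (w x y)) ⟩
      ∑[ x < k ] w x y           ≤⟨ arriving y ⟩
      c                          ≡⟨ +-identityʳ c ⟨
      1 * c                      ∎
    ... | no y∉N = begin
      ∑[ x < k ] (χX x * w x y)  ≤⟨ ∑-mono-≤ vanishes ⟩
      ∑[ x < k ] 0               ≡⟨ sum-replicate-zero k ⟩
      0                          ∎
      where
      vanishes : ∀ x → χX x * w x y ≤ 0
      vanishes x with x ∈? X | w x y in eq
      ... | no _    | _     = z≤n
      ... | yes _   | zero  = ≤-reflexive (*-zeroʳ 1)
      ... | yes x∈X | suc _ = contradiction (N⁺ ∈⊤ x∈X (subst (0 <_) (sym eq) z<s)) y∉N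

  hall-weighted : ∀ c .{{_ : NonZero c}} →
    (∀ x → c ≤ ∑[ y < m ] w x y) → (∀ y → ∑[ x < k ] w x y ≤ c) →
    Σ (Fin k → Fin m) λ f → (∀ x → 0 < w x (f x)) × Injective _≡_ _≡_ f
  hall-weighted c leaving arriving = hall (hallCondition-weighted c leaving arriving)

module _ where
  open import Data.List using (List; []; _∷_; [_]; length; filter; tabulate; allFin; lookup)
  open import Data.List.Properties using (filter-notAll; tabulate-lookup)
  open import Data.List.Relation.Unary.All as All using ([]; _∷_)
  open import Data.List.Relation.Unary.Any as Any using (here; there)
  open import Data.List.Relation.Unary.AllPairs using ([]; _∷_)
  open import Data.List.Relation.Unary.Unique.Propositional using (Unique)
  open import Data.List.Relation.Unary.Unique.Propositional.Properties using (filter⁺)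
  open import Data.List.Membership.Propositional using (_∈_)
  open import Data.List.Membership.Propositional.Properties using (∈-filter⁺; ∈-filter⁻; ∈-allFin; ∈-lookup)
  open import Relation.Nullary using (¬?)
  open import Relation.Binary.Definitions using (DecidableEquality)

  count : ∀ {a ℓ} {A : Set a} {P : Pred A ℓ} → Decidable P → List A → ℕ
  count P? xs = length (filter P? xs)

  count-tabulate : ∀ {a ℓ} {A : Set a} {n} {P : Pred A ℓ} (P? : Decidable P) (f : Fin n → A) →
                   count P? (tabulate f) ≡ ∑[ i < n ] 𝟙 (does (P? (f i)))
  count-tabulate {n = zero}  P? f = refl
  count-tabulate {n = suc n} P? f with does (P? (f zero))
  ... | true  = cong suc (count-tabulate P? (f ∘ suc))
  ... | false = count-tabulate P? (f ∘ suc)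

  ∑-lookup : ∀ {a ℓ} {A : Set a} {P : Pred A ℓ} (P? : Decidable P) (xs : List A) →
             ∑[ i < length xs ] 𝟙 (does (P? (lookup xs i))) ≡ count P? xs
  ∑-lookup P? xs = trans (sym (count-tabulate P? (lookup xs))) (cong (count P?) (tabulate-lookup xs))

  module _ {b} {B : Set b} (_≟_ : DecidableEquality B) where

    length-≤-Unique : ∀ {xs ys : List B} → Unique xs → (∀ {z} → z ∈ xs → z ∈ ys) → length xs ≤ length ys
    length-≤-Unique {[]}     _            _      = z≤n
    length-≤-Unique {x ∷ xs} {ys} (x∉xs ∷ xs-unique) xs⊆ys = begin-strict
      length xs                  ≤⟨ length-≤-Unique xs-unique xs⊆ys-x ⟩
      length (filter ≢x? ys)     <⟨ filter-notAll ≢x? ys (Any.map (λ x≡y y≢x → y≢x (sym x≡y)) (xs⊆ys (here refl))) ⟩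
      length ys                  ∎
      where
      open ≤-Reasoning
      ≢x? : Decidable (λ y → ¬ y ≡ x)
      ≢x? y = ¬? (y ≟ x)
      xs⊆ys-x : ∀ {z} → z ∈ xs → z ∈ filter ≢x? ys
      xs⊆ys-x z∈xs = ∈-filter⁺ ≢x? (xs⊆ys (there z∈xs)) (All.lookup x∉xs z∈xs ∘ sym)

    count-≟-≤1 : ∀ {xs : List B} → Unique xs → ∀ y → count (_≟ y) xs ≤ 1
    count-≟-≤1 {xs} xs-unique y = length-≤-Unique {ys = [ y ]} (filter⁺ (_≟ y) xs-unique) (λ z∈ → here (proj₂ (∈-filter⁻ (_≟ y) {xs = xs} z∈)))

    lookup-injective : ∀ {xs : List B} → Unique xs → ∀ {i j} → lookup xs i ≡ lookup xs j → i ≡ j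
    lookup-injective {x ∷ xs} _            {zero}  {zero}  _  = refl
    lookup-injective {x ∷ xs} (x∉xs ∷ _)   {zero}  {suc j} eq = contradiction eq (All.lookup x∉xs (∈-lookup j))
    lookup-injective {x ∷ xs} (x∉xs ∷ _)   {suc i} {zero}  eq = contradiction (sym eq) (All.lookup x∉xs (∈-lookup i))
    lookup-injective {x ∷ xs} (_ ∷ xs-unique)    {suc i} {suc j} eq = cong suc (lookup-injective xs-unique eq)

  count-Unique-≤ : ∀ {ℓ} {n} {xs : List (Fin n)} {P Q : Pred (Fin n) ℓ} (P? : Decidable P) (Q? : Decidable Q) →
                   Unique xs → (∀ {v} → v ∈ xs → P v → Q v) → count P? xs ≤ count Q? (allFin n)
  count-Unique-≤ P? Q? xs-unique P⇒Q = length-≤-Unique _≟ᶠ_ (filter⁺ P? xs-unique) λ v∈ →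
    let v∈xs , Pv = ∈-filter⁻ P? v∈ in ∈-filter⁺ Q? (∈-allFin _) (P⇒Q v∈xs Pv)

-- Edges as sorted pairs of vertices

module _ where
  import Data.Fin as Fin
  import Data.Fin.Properties as Finₚ
  open import Data.Sum using (swap)
  open import Data.Bool.Properties using (T-∧)
  open import Data.Product using (uncurry)
  open import Data.Product.Properties using (×-≡,≡←≡)
  open import Function using (Equivalence)
  open import Relation.Binary using (tri<; tri≈; tri>)

  -- An unordered pair of vertices, stored with its smaller vertex first as in Edge.
  minmax : ∀ {n} → Fin n → Fin n → Fin n × Fin n
  minmax a b with Finₚ.<-cmp a b
  ... | tri< _ _ _ = a , b
  ... | tri≈ _ _ _ = a , b
  ... | tri> _ _ _ = b , a

  minmax-cases : ∀ {n} (a b : Fin n) → minmax a b ≡ (a , b) ⊎ minmax a b ≡ (b , a)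
  minmax-cases a b with Finₚ.<-cmp a b
  ... | tri< _ _ _ = inj₁ refl
  ... | tri≈ _ _ _ = inj₁ refl
  ... | tri> _ _ _ = inj₂ refl

  minmax-comm : ∀ {n} {a b : Fin n} → a ≢ b → minmax a b ≡ minmax b a
  minmax-comm {a = a} {b} a≢b with Finₚ.<-cmp a b | Finₚ.<-cmp b a
  ... | tri≈ _ a≡b _ | _             = contradiction a≡b a≢b
  ... | _            | tri≈ _ b≡a _  = contradiction (sym b≡a) a≢b
  ... | tri< _ _ _   | tri> _ _ _    = refl
  ... | tri> _ _ _   | tri< _ _ _    = refl
  ... | tri< a<b _ _ | tri< b<a _ _  = contradiction b<a (Finₚ.<-asym a<b)
  ... | tri> _ _ b<a | tri> _ _ a<b  = contradiction b<a (Finₚ.<-asym a<b)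

  minmax-< : ∀ {n} {a b : Fin n} → a ≢ b → proj₁ (minmax a b) Fin.< proj₂ (minmax a b)
  minmax-< {a = a} {b} a≢b with Finₚ.<-cmp a b
  ... | tri< a<b _ _   = a<b
  ... | tri≈ _ a≡b _   = contradiction a≡b a≢b
  ... | tri> _ _ b<a   = b<a

  minmax-sym : ∀ {n} (P : Fin n → Fin n → Set) → (∀ {a b} → P a b → P b a) →
               ∀ {a b} → P a b → uncurry P (minmax a b)
  minmax-sym P P-sym {a} {b} pab with minmax-cases a b
  ... | inj₁ eq rewrite eq = pab
  ... | inj₂ eq rewrite eq = P-sym pab

  minmax-injective : ∀ {n} {a b c d : Fin n} → minmax a b ≡ minmax c d → (a ≡ c × b ≡ d) ⊎ (a ≡ d × b ≡ c)
  minmax-injective {a = a} {b} {c} {d} eq with minmax-cases a b | minmax-cases c d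
  ... | inj₁ e₁ | inj₁ e₂ = inj₁ (×-≡,≡←≡ (trans (sym e₁) (trans eq e₂)))
  ... | inj₁ e₁ | inj₂ e₂ = inj₂ (×-≡,≡←≡ (trans (sym e₁) (trans eq e₂)))
  ... | inj₂ e₁ | inj₁ e₂ = let b≡c , a≡d = ×-≡,≡←≡ (trans (sym e₁) (trans eq e₂)) in inj₂ (a≡d , b≡c)
  ... | inj₂ e₁ | inj₂ e₂ = let b≡d , a≡c = ×-≡,≡←≡ (trans (sym e₁) (trans eq e₂)) in inj₁ (a≡c , b≡d)

  minmax-diagonal : ∀ {n} {a b i : Fin n} → minmax a b ≡ (i , i) → a ≡ b
  minmax-diagonal {a = a} {b} eq with minmax-cases a b
  ... | inj₁ e = let a≡i , b≡i = ×-≡,≡←≡ (trans (sym e) eq) in trans a≡i (sym b≡i)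
  ... | inj₂ e = let b≡i , a≡i = ×-≡,≡←≡ (trans (sym e) eq) in trans a≡i (sym b≡i)

  _∈ₑ_ : ∀ {n} → Fin n → Fin n × Fin n → Set
  z ∈ₑ (a , b) = z ≡ a ⊎ z ≡ b

  ∈ₑ-minmax : ∀ {n} {z} (a b : Fin n) → z ∈ₑ minmax a b → z ∈ₑ (a , b)
  ∈ₑ-minmax a b z∈ with minmax-cases a b
  ... | inj₁ eq rewrite eq = z∈
  ... | inj₂ eq rewrite eq = swap z∈

  shareEnd⇒common : ∀ {n} (e f : Fin n × Fin n) → T (shareEnd e f) → ∃ λ z → z ∈ₑ e × z ∈ₑ f
  shareEnd⇒common (a , b) (c , d) shared with a ≟ᶠ c | a ≟ᶠ d | b ≟ᶠ c | b ≟ᶠ d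
  ... | yes a≡c | _       | _       | _       = a , inj₁ refl , inj₁ a≡c
  ... | no _    | yes a≡d | _       | _       = a , inj₁ refl , inj₂ a≡d
  ... | no _    | no _    | yes b≡c | _       = b , inj₂ refl , inj₁ b≡c
  ... | no _    | no _    | no _    | yes b≡d = b , inj₂ refl , inj₂ b≡d

  lineAdj-irrefl : ∀ {n} (G : SimpleGraph n) e → ¬ T (lineAdj G e e)
  lineAdj-irrefl G ((a , b) , _) e~e with a ≟ᶠ a | b ≟ᶠ b
  ... | yes _  | yes _  = e~e
  ... | no a≢a | _      = a≢a refl
  ... | yes _  | no b≢b = b≢b refl

  lineAdj⇒common : ∀ {n} (G : SimpleGraph n) e f → T (lineAdj G e f) → ∃ λ z → z ∈ₑ proj₁ e × z ∈ₑ proj₁ f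
  lineAdj⇒common G e f e~f = shareEnd⇒common (proj₁ e) (proj₁ f) (proj₂ (Equivalence.to T-∧ e~f))

-- The chosen edges

module _ where
  open import Data.List using (List; length; tabulate; lookup; allFin)
  open import Data.List.Properties using (length-tabulate)
  open import Data.List.Relation.Unary.Any as Any using (here; there)
  open import Data.List.Relation.Unary.Any.Properties using (lookup-index)
  open import Data.List.Relation.Unary.AllPairs using ([]; _∷_)
  open import Data.List.Relation.Unary.All using ([]; _∷_)
  open import Data.List.Relation.Unary.Unique.Propositional using (Unique)
  open import Data.List.Relation.Unary.Unique.Propositional.Properties using (tabulate⁺)
  open import Data.List.Membership.Propositional using (_∈_; _∉_)
  open import Data.List.Membership.Propositional.Properties using (∈-filter⁺; ∈-lookup; ∈-tabulate⁻)
  open import Relation.Nullary.Decidable.Core using (T?)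

  module Construction {n} (G : SimpleGraph n) {r} (regular : IsRegular G r) (2≤r : 2 ≤ r)
                      {S : List (Fin n)} (S-unique : Unique S)
                      (S-degree≤2 : ∀ {v} → v ∈ S → count (T? ∘ adj G v) S ≤ 2) where

    open import Data.Fin using (combine; remQuot)
    open import Data.Fin.Properties using (remQuot-combine; combine-remQuot)
    open import Data.Product using (uncurry)
    open import Data.Product.Properties using (×-≡,≡←≡)
    open import Data.List.Membership.DecPropositional (_≟ᶠ_ {n}) using (_∈?_)

    A : Fin n → Fin n → Bool
    A = adj G

    adjacent-sym : ∀ {u v} → T (A u v) → T (A v u)
    adjacent-sym {u} {v} = subst T (SimpleGraph.sym G u v)

    adjacent⇒≢ : ∀ {u v} → T (A u v) → u ≢ v
    adjacent⇒≢ {u} Auu refl = subst T (irrefl G u) Auu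

    dS : Fin n → ℕ
    dS v = count (T? ∘ A v) S

    S-neighbours-≤ : ∀ {t} {zs : List (Fin n)} → Unique zs → (∀ {z} → z ∈ zs → z ∈ S × T (A t z)) →
                     length zs ≤ dS t
    S-neighbours-≤ {t} zs-unique zs⊆ = length-≤-Unique _≟ᶠ_ zs-unique λ z∈zs →
      let z∈S , Atz = zs⊆ z∈zs in ∈-filter⁺ (T? ∘ A t) z∈S Atz

    degree≡∑ : ∀ v → ∑[ w < n ] 𝟙 (A v w) ≡ r
    degree≡∑ v = trans (sym (count-tabulate (T? ∘ A v) id)) (regular v)

    dS≤∑ : ∀ s → dS s ≤ ∑[ w < n ] 𝟙 (does (T? (A s w) ×-dec w ∈? S))
    dS≤∑ s = subst (dS s ≤_) (count-tabulate (λ w → T? (A s w) ×-dec w ∈? S) id)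
                   (count-Unique-≤ (T? ∘ A s) _ S-unique (λ w∈S Asw → Asw , w∈S))

    -- Through its neighbour w, the vertex s claims the edge {s , w} if w ∈ S and otherwise
    -- the vertex w, encoded as the pair (w , w); share s w is the weight of that claim.
    target : Fin n → Fin n → Fin n × Fin n
    target s w with w ∈? S
    ... | yes _ = minmax s w
    ... | no  _ = w , w

    target-∈ : ∀ {s w} → w ∈ S → target s w ≡ minmax s w
    target-∈ {s} {w} w∈S with w ∈? S
    ... | yes _   = refl
    ... | no  w∉S = contradiction w∈S w∉S

    target-∉ : ∀ {s w} → w ∉ S → target s w ≡ (w , w)
    target-∉ {s} {w} w∉S with w ∈? S
    ... | yes w∈S = contradiction w∈S w∉S
    ... | no  _   = refl

    share : Fin n → Fin n → ℕ
    share s w with A s w | w ∈? S | dS s ≤? 1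
    ... | false | _     | _     = 0
    ... | true  | yes _ | _     = r
    ... | true  | no _  | yes _ = 2
    ... | true  | no _  | no _  = 0

    share-adjacent : ∀ {s w} → 0 < share s w → T (A s w)
    share-adjacent {s} {w} pos with A s w | w ∈? S | dS s ≤? 1
    ... | true  | _ | _ = _
    ... | false | _ | _ = contradiction pos (<-irrefl refl)

    share-outside-sparse : ∀ {s w} → w ∉ S → 0 < share s w → dS s ≤ 1
    share-outside-sparse {s} {w} w∉S pos with A s w | w ∈? S | dS s ≤? 1
    ... | _     | yes w∈S | _      = contradiction w∈S w∉S
    ... | true  | no _    | yes ≤1 = ≤1
    ... | true  | no _    | no _   = contradiction pos (<-irrefl refl)
    ... | false | no _    | _      = contradiction pos (<-irrefl refl)

    share-≤ : ∀ s w → share s w ≤ r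
    share-≤ s w with A s w | w ∈? S | dS s ≤? 1
    ... | false | _     | _     = z≤n
    ... | true  | yes _ | _     = ≤-refl
    ... | true  | no _  | yes _ = 2≤r
    ... | true  | no _  | no _  = z≤n

    share-outside-≤ : ∀ s {w} → w ∉ S → share s w ≤ 2 * 𝟙 (A s w)
    share-outside-≤ s {w} w∉S with A s w | w ∈? S | dS s ≤? 1
    ... | _     | yes w∈S | _     = contradiction w∈S w∉S
    ... | false | no _    | _     = z≤n
    ... | true  | no _    | yes _ = ≤-refl
    ... | true  | no _    | no _  = z≤n

    share-sparse-≥ : ∀ {s} → dS s ≤ 1 → ∀ w → 2 * 𝟙 (A s w) ≤ share s w
    share-sparse-≥ {s} ≤1 w with A s w | w ∈? S | dS s ≤? 1
    ... | false | _     | _     = z≤n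
    ... | true  | yes _ | _     = 2≤r
    ... | true  | no _  | yes _ = ≤-refl
    ... | true  | no _  | no ≰1 = contradiction ≤1 ≰1

    share-inside-≥ : ∀ s w → r * 𝟙 (does (T? (A s w) ×-dec w ∈? S)) ≤ share s w
    share-inside-≥ s w with A s w | w ∈? S | dS s ≤? 1
    ... | false | _     | _     = ≤-trans (≤-reflexive (*-zeroʳ r)) z≤n
    ... | true  | yes _ | _     = ≤-reflexive (*-identityʳ r)
    ... | true  | no _  | _     = ≤-trans (≤-reflexive (*-zeroʳ r)) z≤n

    share-total : ∀ s → 2 * r ≤ ∑[ w < n ] share s w
    share-total s = by-sparsity (dS s ≤? 1)
      where
      open ≤-Reasoning
      by-sparsity : Dec (dS s ≤ 1) → 2 * r ≤ ∑[ w < n ] share s w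
      by-sparsity (yes ≤1) = begin
        2 * r                       ≡⟨ cong (2 *_) (degree≡∑ s) ⟨
        2 * ∑[ w < n ] 𝟙 (A s w)    ≡⟨ *-distribˡ-sum 2 (𝟙 ∘ A s) ⟩
        ∑[ w < n ] (2 * 𝟙 (A s w))  ≤⟨ ∑-mono-≤ (share-sparse-≥ ≤1) ⟩
        ∑[ w < n ] share s w        ∎
      by-sparsity (no ≰1) = begin
        2 * r                                                ≡⟨ *-comm 2 r ⟩
        r * 2                                                ≤⟨ *-monoʳ-≤ r (≤-trans (≰⇒> ≰1) (dS≤∑ s)) ⟩
        r * ∑[ w < n ] 𝟙 (does (T? (A s w) ×-dec w ∈? S))    ≡⟨ *-distribˡ-sum r (λ w → 𝟙 (does (T? (A s w) ×-dec w ∈? S))) ⟩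
        ∑[ w < n ] (r * 𝟙 (does (T? (A s w) ×-dec w ∈? S)))  ≤⟨ ∑-mono-≤ (share-inside-≥ s) ⟩
        ∑[ w < n ] share s w                                 ∎

    code : Fin n × Fin n → Fin (n * n)
    code = uncurry combine

    code-injective : ∀ {p q} → code p ≡ code q → p ≡ q
    code-injective {i , j} {i′ , j′} eq =
      trans (sym (remQuot-combine i j)) (trans (cong (remQuot n) eq) (remQuot-combine i′ j′))

    k : ℕ
    k = length S

    σ : Fin k → Fin n
    σ = lookup S

    σ∈S : ∀ x → σ x ∈ S
    σ∈S = ∈-lookup

    σ-injective : ∀ {x x′} → σ x ≡ σ x′ → x ≡ x′
    σ-injective = lookup-injective _≟ᶠ_ S-unique

    weight : Fin k → Fin (n * n) → ℕ
    weight x y = ∑[ w < n ] (𝟙 (does (y ≟ᶠ code (target (σ x) w))) * share (σ x) w)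

    outgoing : ∀ x → 2 * r ≤ ∑[ y < n * n ] weight x y
    outgoing x = begin
      2 * r                                                  ≤⟨ share-total s ⟩
      ∑[ w < n ] share s w                                   ≡⟨ sum-cong-≗ (λ w → ∑-δ (c w) (share s w)) ⟨
      ∑[ w < n ] ∑[ y < n * n ] (𝟙 (does (y ≟ᶠ c w)) * share s w)  ≡⟨ ∑-comm (λ w y → 𝟙 (does (y ≟ᶠ c w)) * share s w) ⟩
      ∑[ y < n * n ] weight x y                              ∎
      where
      open ≤-Reasoning
      s = σ x
      c = λ w → code (target s w)

    vertex-term : ∀ s i w → 𝟙 (does (code (i , i) ≟ᶠ code (target s w))) * share s w ≤
                            𝟙 (does (w ≟ᶠ i)) * (2 * 𝟙 (A s i))
    vertex-term s i w with code (i , i) ≟ᶠ code (target s w)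
    ... | no _   = z≤n
    ... | yes eq = ≤-trans (≤-reflexive (*-identityˡ _)) (by-membership (w ∈? S))
      where
      by-membership : Dec (w ∈ S) → share s w ≤ 𝟙 (does (w ≟ᶠ i)) * (2 * 𝟙 (A s i))
      by-membership (yes w∈S) = ≤-trans (≮⇒≥ λ pos → adjacent⇒≢ (share-adjacent pos) s≡w) z≤n
        where
        s≡w : s ≡ w
        s≡w = minmax-diagonal (sym (trans (code-injective eq) (target-∈ w∈S)))
      by-membership (no w∉S) = ≤𝟙* (w ≟ᶠ i) w≡i
        (≤-trans (share-outside-≤ s w∉S) (≤-reflexive (cong (λ v → 2 * 𝟙 (A s v)) w≡i)))
        where
        w≡i : w ≡ i
        w≡i = sym (proj₁ (×-≡,≡←≡ (trans (code-injective eq) (target-∉ w∉S))))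

    edge-term : ∀ s {i j} → i ≢ j → ∀ w →
                𝟙 (does (code (i , j) ≟ᶠ code (target s w))) * share s w ≤
                𝟙 (does (w ≟ᶠ j)) * (𝟙 (does (s ≟ᶠ i)) * r) + 𝟙 (does (w ≟ᶠ i)) * (𝟙 (does (s ≟ᶠ j)) * r)
    edge-term s {i} {j} i≢j w with code (i , j) ≟ᶠ code (target s w)
    ... | no _   = z≤n
    ... | yes eq = ≤-trans (≤-reflexive (*-identityˡ _)) (by-membership (w ∈? S))
      where
      by-membership : Dec (w ∈ S) →
        share s w ≤ 𝟙 (does (w ≟ᶠ j)) * (𝟙 (does (s ≟ᶠ i)) * r) + 𝟙 (does (w ≟ᶠ i)) * (𝟙 (does (s ≟ᶠ j)) * r)
      by-membership (no w∉S) =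
        let i≡w , j≡w = ×-≡,≡←≡ (trans (code-injective eq) (target-∉ w∉S)) in
        contradiction (trans i≡w (sym j≡w)) i≢j
      by-membership (yes w∈S) with minmax-cases s w
      ... | inj₁ e = let i≡s , j≡w = ×-≡,≡←≡ (trans (trans (code-injective eq) (target-∈ w∈S)) e) in
        ≤-trans (≤𝟙* (w ≟ᶠ j) (sym j≡w) (≤𝟙* (s ≟ᶠ i) (sym i≡s) (share-≤ s w))) (m≤m+n _ _)
      ... | inj₂ e = let i≡w , j≡s = ×-≡,≡←≡ (trans (trans (code-injective eq) (target-∈ w∈S)) e) in
        ≤-trans (≤𝟙* (w ≟ᶠ i) (sym i≡w) (≤𝟙* (s ≟ᶠ j) (sym j≡s) (share-≤ s w))) (m≤n+m _ _)

    vertex-incoming : ∀ i → ∑[ x < k ] weight x (code (i , i)) ≤ 2 * r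
    vertex-incoming i = begin
      ∑[ x < k ] weight x (code (i , i))                          ≤⟨ ∑-mono-≤ (λ x → ∑-mono-≤ (vertex-term (σ x) i)) ⟩
      ∑[ x < k ] ∑[ w < n ] (𝟙 (does (w ≟ᶠ i)) * (2 * 𝟙 (A (σ x) i)))  ≡⟨ sum-cong-≗ (λ x → ∑-δ i (2 * 𝟙 (A (σ x) i))) ⟩
      ∑[ x < k ] (2 * 𝟙 (A (σ x) i))                              ≡⟨ *-distribˡ-sum 2 (λ x → 𝟙 (A (σ x) i)) ⟨
      2 * ∑[ x < k ] 𝟙 (A (σ x) i)                                ≡⟨ cong (2 *_) (∑-lookup (λ v → T? (A v i)) S) ⟩
      2 * count (λ v → T? (A v i)) S                              ≤⟨ *-monoʳ-≤ 2 (count-Unique-≤ _ (T? ∘ A i) S-unique (λ _ → adjacent-sym)) ⟩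
      2 * count (T? ∘ A i) (allFin n)                             ≡⟨ cong (2 *_) (regular i) ⟩
      2 * r                                                       ∎
      where open ≤-Reasoning

    edge-incoming : ∀ {i j} → i ≢ j → ∑[ x < k ] weight x (code (i , j)) ≤ 2 * r
    edge-incoming {i} {j} i≢j = begin
      ∑[ x < k ] weight x (code (i , j))                          ≤⟨ ∑-mono-≤ (λ x → ∑-mono-≤ (edge-term (σ x) i≢j)) ⟩
      ∑[ x < k ] ∑[ w < n ] (𝟙 (does (w ≟ᶠ j)) * χ i x + 𝟙 (does (w ≟ᶠ i)) * χ j x)  ≡⟨ sum-cong-≗ δδ ⟩
      ∑[ x < k ] (χ i x + χ j x)                                  ≡⟨ ∑-distrib-+ (χ i) (χ j) ⟩
      ∑[ x < k ] χ i x + ∑[ x < k ] χ j x                         ≡⟨ cong₂ _+_ (*-distribʳ-sum r (𝟙 ∘ is i)) (*-distribʳ-sum r (𝟙 ∘ is j)) ⟨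
      ∑[ x < k ] 𝟙 (is i x) * r + ∑[ x < k ] 𝟙 (is j x) * r         ≡⟨ cong₂ _+_ (cong (_* r) (∑-lookup (_≟ᶠ i) S)) (cong (_* r) (∑-lookup (_≟ᶠ j) S)) ⟩
      count (_≟ᶠ i) S * r + count (_≟ᶠ j) S * r                   ≤⟨ +-mono-≤ (*-monoˡ-≤ r (count-≟-≤1 _≟ᶠ_ S-unique i)) (*-monoˡ-≤ r (count-≟-≤1 _≟ᶠ_ S-unique j)) ⟩
      1 * r + 1 * r                                               ≡⟨ *-distribʳ-+ r 1 1 ⟨
      2 * r                                                       ∎
      where
      open ≤-Reasoning
      is : Fin n → Fin k → Bool
      is v x = does (σ x ≟ᶠ v)
      χ : Fin n → Fin k → ℕ
      χ v x = 𝟙 (is v x) * r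
      δδ : ∀ x → ∑[ w < n ] (𝟙 (does (w ≟ᶠ j)) * χ i x + 𝟙 (does (w ≟ᶠ i)) * χ j x) ≡ χ i x + χ j x
      δδ x = trans (∑-distrib-+ (λ w → 𝟙 (does (w ≟ᶠ j)) * χ i x) (λ w → 𝟙 (does (w ≟ᶠ i)) * χ j x)) (cong₂ _+_ (∑-δ j (χ i x)) (∑-δ i (χ j x)))

    incoming : ∀ y → ∑[ x < k ] weight x y ≤ 2 * r
    incoming y = subst (λ y → ∑[ x < k ] weight x y ≤ 2 * r) (combine-remQuot {n} n y) (by-pair (remQuot n y))
      where
      by-pair : ∀ p → ∑[ x < k ] weight x (code p) ≤ 2 * r
      by-pair (i , j) with i ≟ᶠ j
      ... | yes refl = vertex-incoming i
      ... | no  i≢j  = edge-incoming i≢j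

    matching : Σ (Fin k → Fin (n * n)) λ f → (∀ x → 0 < weight x (f x)) × Injective _≡_ _≡_ f
    matching = hall-weighted weight (2 * r) {{>-nonZero (*-monoʳ-< 2 (≤-trans (s≤s z≤n) 2≤r))}}
                             outgoing incoming

    -- Abstracting over the matching keeps its definition, a run of Hall's algorithm, from
    -- being unfolded while the lemmas below are type checked.
    module Assignment (claim : Fin k → Fin (n * n)) (claim-weighted : ∀ x → 0 < weight x (claim x))
                      (claim-injective : Injective _≡_ _≡_ claim) where

      claimed-through : ∀ x → ∃ λ w → 0 < 𝟙 (does (claim x ≟ᶠ code (target (σ x) w))) * share (σ x) w
      claimed-through x = ∑-positive (λ w → 𝟙 (does (claim x ≟ᶠ code (target (σ x) w))) * share (σ x) w)
                                     (claim-weighted x)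

      partner : Fin k → Fin n
      partner x = proj₁ (claimed-through x)

      partner-spec : ∀ x → claim x ≡ code (target (σ x) (partner x)) × 0 < share (σ x) (partner x)
      partner-spec x = 𝟙*-positive (claim x ≟ᶠ _) (proj₂ (claimed-through x))

      partner-adjacent : ∀ x → T (A (σ x) (partner x))
      partner-adjacent x = share-adjacent (proj₂ (partner-spec x))

      partner-outside-sparse : ∀ x → partner x ∉ S → dS (σ x) ≤ 1
      partner-outside-sparse x p∉S = share-outside-sparse p∉S (proj₂ (partner-spec x))

      claim-inside : ∀ x → partner x ∈ S → claim x ≡ code (minmax (σ x) (partner x))
      claim-inside x p∈S = trans (proj₁ (partner-spec x)) (cong code (target-∈ p∈S))

      claim-outside : ∀ x → partner x ∉ S → claim x ≡ code (partner x , partner x)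
      claim-outside x p∉S = trans (proj₁ (partner-spec x)) (cong code (target-∉ p∉S))

      crossed-partners : ∀ {x x′} → σ x ≡ partner x′ → σ x′ ≡ partner x → x ≡ x′
      crossed-partners {x} {x′} σx≡p′ σx′≡p = claim-injective (begin
        claim x                             ≡⟨ claim-inside x (subst (_∈ S) σx′≡p (σ∈S x′)) ⟩
        code (minmax (σ x) (partner x))     ≡⟨ cong code (cong₂ minmax σx≡p′ (sym σx′≡p)) ⟩
        code (minmax (partner x′) (σ x′))   ≡⟨ cong code (minmax-comm (adjacent⇒≢ (partner-adjacent x′) ∘ sym)) ⟩
        code (minmax (σ x′) (partner x′))   ≡⟨ claim-inside x′ (subst (_∈ S) σx≡p′ (σ∈S x)) ⟨
        claim x′                            ∎)
        where open ≡-Reasoning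

      shared-partner-∉S : ∀ {x x′} → x ≢ x′ → partner x ≡ partner x′ → partner x ∉ S
      shared-partner-∉S {x} {x′} x≢x′ p≡p′ t∈S = by-partner-of-t (u ∈? S)
        where
        t = partner x
        xt = Any.index t∈S
        u = partner xt

        σxt≡t : σ xt ≡ t
        σxt≡t = sym (lookup-index t∈S)

        t~s : T (A t (σ x))
        t~s = adjacent-sym (partner-adjacent x)

        t~s′ : T (A t (σ x′))
        t~s′ = adjacent-sym (subst (T ∘ A (σ x′)) (sym p≡p′) (partner-adjacent x′))

        t~u : T (A t u)
        t~u = subst (λ v → T (A v u)) σxt≡t (partner-adjacent xt)

        s≢s′ : σ x ≢ σ x′
        s≢s′ = x≢x′ ∘ σ-injective

        u≢σ : ∀ {y} → partner y ≡ t → u ≢ σ y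
        u≢σ {y} py≡t u≡σy = adjacent⇒≢ t~u (begin
          t      ≡⟨ σxt≡t ⟨
          σ xt   ≡⟨ cong σ (crossed-partners (trans σxt≡t (sym py≡t)) (sym u≡σy)) ⟩
          σ y    ≡⟨ u≡σy ⟨
          u      ∎)
          where open ≡-Reasoning

        two : 2 ≤ dS t
        two = S-neighbours-≤ ((s≢s′ ∷ []) ∷ [] ∷ []) λ where
          (here refl)         → σ∈S x  , t~s
          (there (here refl)) → σ∈S x′ , t~s′

        three : u ∈ S → 3 ≤ dS t
        three u∈S = S-neighbours-≤ ((s≢s′ ∷ (u≢σ refl ∘ sym) ∷ []) ∷ ((u≢σ (sym p≡p′) ∘ sym) ∷ []) ∷ [] ∷ []) λ where
          (here refl)                 → σ∈S x  , t~s
          (there (here refl))         → σ∈S x′ , t~s′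
          (there (there (here refl))) → u∈S    , t~u

        by-partner-of-t : Dec (u ∈ S) → ⊥
        by-partner-of-t (no  u∉S) = <⇒≱ two (subst (λ v → dS v ≤ 1) σxt≡t (partner-outside-sparse xt u∉S))
        by-partner-of-t (yes u∈S) = <⇒≱ (three u∈S) (S-degree≤2 t∈S)

      partner-injective : ∀ {x x′} → partner x ≡ partner x′ → x ≡ x′
      partner-injective {x} {x′} p≡p′ with x ≟ᶠ x′
      ... | yes x≡x′ = x≡x′
      ... | no  x≢x′ = claim-injective (begin
        claim x                          ≡⟨ claim-outside x t∉S ⟩
        code (partner x , partner x)     ≡⟨ cong (λ v → code (v , v)) p≡p′ ⟩
        code (partner x′ , partner x′)   ≡⟨ claim-outside x′ (subst (_∉ S) p≡p′ t∉S) ⟨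
        claim x′                         ∎)
        where
        open ≡-Reasoning
        t∉S = shared-partner-∉S x≢x′ p≡p′

      edge : Fin k → Edge G
      edge x = minmax (σ x) (partner x)
             , minmax-< (adjacent⇒≢ (partner-adjacent x))
             , minmax-sym (λ a b → T (A a b)) adjacent-sym (partner-adjacent x)

      edge-injective : ∀ {x x′} → edge x ≡ edge x′ → x ≡ x′
      edge-injective eq with minmax-injective (cong proj₁ eq)
      ... | inj₁ (σx≡σx′ , _)      = σ-injective σx≡σx′
      ... | inj₂ (σx≡p′ , p≡σx′)   = crossed-partners σx≡p′ (sym p≡σx′)

      edge-line-adjacent⇒≢ : ∀ {x x′} → T (lineAdj G (edge x) (edge x′)) → x ≢ x′
      edge-line-adjacent⇒≢ {x} e~e′ refl = lineAdj-irrefl G (edge x) e~e′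

      edge-line-adjacent⇒adjacent : ∀ x x′ → T (lineAdj G (edge x) (edge x′)) → T (A (σ x) (σ x′))
      edge-line-adjacent⇒adjacent x x′ e~e′ with lineAdj⇒common G (edge x) (edge x′) e~e′
      ... | z , z∈e , z∈e′ with ∈ₑ-minmax (σ x) (partner x) z∈e | ∈ₑ-minmax (σ x′) (partner x′) z∈e′
      ...   | inj₁ z≡s | inj₁ z≡s′ =
        contradiction (σ-injective (trans (sym z≡s) z≡s′)) (edge-line-adjacent⇒≢ e~e′)
      ...   | inj₁ z≡s | inj₂ z≡p′ =
        adjacent-sym (subst (T ∘ A (σ x′)) (trans (sym z≡p′) z≡s) (partner-adjacent x′))
      ...   | inj₂ z≡p | inj₁ z≡s′ =
        subst (T ∘ A (σ x)) (trans (sym z≡p) z≡s′) (partner-adjacent x)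
      ...   | inj₂ z≡p | inj₂ z≡p′ =
        contradiction (partner-injective (trans (sym z≡p) z≡p′)) (edge-line-adjacent⇒≢ e~e′)

      line-degree≤dS : ∀ x → count (T? ∘ lineAdj G (edge x)) (tabulate edge) ≤ dS (σ x)
      line-degree≤dS x = begin
        count (T? ∘ lineAdj G (edge x)) (tabulate edge)  ≡⟨ count-tabulate (T? ∘ lineAdj G (edge x)) edge ⟩
        ∑[ x′ < k ] 𝟙 (lineAdj G (edge x) (edge x′))     ≤⟨ ∑-mono-≤ (λ x′ → 𝟙-mono (edge-line-adjacent⇒adjacent x x′)) ⟩
        ∑[ x′ < k ] 𝟙 (A (σ x) (σ x′))                   ≡⟨ ∑-lookup (T? ∘ A (σ x)) S ⟩
        dS (σ x)                                         ∎
        where open ≤-Reasoning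

      independent-edges : ∀ {q} → (∀ {v} → v ∈ S → dS v ≤ q) →
                          Σ (List (Edge G)) λ T → IsPIndep (lineAdj G) q T × length S ≤ length T
      independent-edges {q} S-sparse =
        tabulate edge , (tabulate⁺ edge-injective , edges-sparse) , ≤-reflexive (sym (length-tabulate edge))
        where
        edges-sparse : ∀ e → e ∈ tabulate edge → count (T? ∘ lineAdj G e) (tabulate edge) ≤ q
        edges-sparse e e∈ with ∈-tabulate⁻ e∈
        ... | x , refl = ≤-trans (line-degree≤dS x) (S-sparse (σ∈S x))

theorem10 : (n : ℕ) (G : SimpleGraph n) (r : ℕ) → IsRegular G r → 2 ≤ r →
    (p q : ℕ) → p ≤ q → q < 3 →
    AlphaLe (adj G) p (lineAdj G) q
theorem10 n G r regular 2≤r p q p≤q q<3 S (S-unique , S-sparse) =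
  independent-edges (λ v∈S → ≤-trans (S-sparse _ v∈S) p≤q)
  where
  open Construction G regular 2≤r S-unique (λ v∈S → ≤-trans (S-sparse _ v∈S) (≤-trans p≤q (≤-pred q<3)))
  open Assignment (proj₁ matching) (proj₁ (proj₂ matching)) (proj₂ (proj₂ matching))
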